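{- Let $q$ be a prime power and let $\delta,l,m,n$ be positive integers such that $\gcd(n,m)=1$ and $\delta\le l$. Let $U$ be an $\mathbb{F}_{q^m}$-subspace of $\mathbb{F}_{q^{mn}}^l$ with $\dim_{\mathbb{F}_{q^m}}(U)=\delta$. Then \[\dim_{\mathbb{F}_q}\bigl(U\cap \mathbb{F}_{q^n}^l\bigr)\le \delta.\]
   Context: $\mathbb{F}_{q^n}$ is viewed as the subfield of $\mathbb{F}_{q^{mn}}$ of order $q^n$, so $\mathbb{F}_{q^n}^l\subseteq \mathbb{F}_{q^{mn}}^l$, and $U\cap\mathbb{F}_{q^n}^l$ is an $\mathbb{F}_q$-vector space. -}

module Defs where

open import Level using (Level; _⊔_)
open import Data.Nat using (ℕ; zero; suc; _^_; _≤_)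
open import Data.Nat.Primality using (Prime)
open import Data.Fin using (Fin; zero; suc)
open import Data.Product using (Σ; _×_; ∃; ∃-syntax)
open import Relation.Nullary using (¬_)
open import Relation.Binary.PropositionalEquality using (_≡_)
open import Algebra.Bundles using (CommutativeRing)

IsPrimePower : ℕ → Set
IsPrimePower q = ∃[ p ] ∃[ e ] (Prime p × 1 ≤ e × q ≡ p ^ e)

module _ {c ℓ : Level} (F : CommutativeRing c ℓ) where
  open CommutativeRing F using (Carrier; _≈_; _+_; _*_; -_; 0#; 1#)

  record IsField : Set (c ⊔ ℓ) where
    field
      1≉0     : ¬ (1# ≈ 0#)
      inverse : ∀ x → ¬ (x ≈ 0#) → ∃[ y ] (x * y ≈ 1#)

  record HasCard (N : ℕ) : Set (c ⊔ ℓ) where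
    field
      enum      : Fin N → Carrier
      injective : ∀ i j → enum i ≈ enum j → i ≡ j
      surjective : ∀ x → ∃[ i ] (enum i ≈ x)

  record IsSubfieldOfOrder (S : Carrier → Set ℓ) (N : ℕ) : Set (c ⊔ ℓ) where
    field
      resp      : ∀ {x y} → x ≈ y → S x → S y
      has-0     : S 0#
      has-1     : S 1#
      closed-+  : ∀ {x y} → S x → S y → S (x + y)
      closed-neg : ∀ {x} → S x → S (- x)
      closed-*  : ∀ {x y} → S x → S y → S (x * y)
      closed-inv : ∀ {x y} → S x → x * y ≈ 1# → S y
      enum      : Fin N → Carrier
      enum-in   : ∀ i → S (enum i)
      injective : ∀ i j → enum i ≈ enum j → i ≡ j
      surjective : ∀ x → S x → ∃[ i ] (enum i ≈ x)

  Vec : ℕ → Set c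
  Vec l = Fin l → Carrier

  _≋_ : ∀ {l} → Vec l → Vec l → Set ℓ
  u ≋ v = ∀ i → u i ≈ v i

  zeroV : ∀ {l} → Vec l
  zeroV _ = 0#

  _+V_ : ∀ {l} → Vec l → Vec l → Vec l
  (u +V v) i = u i + v i

  _·V_ : ∀ {l} → Carrier → Vec l → Vec l
  (a ·V v) i = a * v i

  lincomb : ∀ {l k} → (Fin k → Carrier) → (Fin k → Vec l) → Vec l
  lincomb {k = zero}  c v = zeroV
  lincomb {k = suc k} c v = (c zero ·V v zero) +V lincomb (λ j → c (suc j)) (λ j → v (suc j))

  record IsSubspace (K : Carrier → Set ℓ) {l : ℕ} (U : Vec l → Set ℓ) : Set (c ⊔ ℓ) where
    field
      resp    : ∀ {u v} → u ≋ v → U u → U v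
      has-0   : U zeroV
      closed-+ : ∀ {u v} → U u → U v → U (u +V v)
      closed-· : ∀ {a u} → K a → U u → U (a ·V u)

  LinIndep : (K : Carrier → Set ℓ) {l k : ℕ} → (Fin k → Vec l) → Set (c ⊔ ℓ)
  LinIndep K {k = k} v =
    ∀ (a : Fin k → Carrier) → (∀ j → K (a j)) → lincomb a v ≋ zeroV → ∀ j → a j ≈ 0#

  Spans : (K : Carrier → Set ℓ) {l k : ℕ} → (Fin k → Vec l) → (Vec l → Set ℓ) → Set (c ⊔ ℓ)
  Spans K {k = k} v W =
    ∀ w → W w → ∃[ a ] ((∀ j → K (a j)) × lincomb {k = k} a v ≋ w)

  HasDim : (K : Carrier → Set ℓ) {l : ℕ} → (Vec l → Set ℓ) → ℕ → Set (c ⊔ ℓ)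
  HasDim K {l} W d =
    ∃[ b ] ((∀ j → W (b j)) × LinIndep K {l} {d} b × Spans K b W)

  DimLe : (K : Carrier → Set ℓ) {l : ℕ} → (Vec l → Set ℓ) → ℕ → Set (c ⊔ ℓ)
  DimLe K {l} W d =
    ∀ k (v : Fin k → Vec l) → (∀ j → W (v j)) → LinIndep K v → k ≤ d

  _∩Sub_ : ∀ {l} → (Vec l → Set ℓ) → (Carrier → Set ℓ) → Vec l → Set ℓ
  (U ∩Sub S) u = U u × (∀ i → S (u i))

module Submission where

-- Let e_1..e_t be an F_q-basis of F_{q^m}. Coprimality makes e linearly
-- independent over F_{q^n}: the F_{q^n}-span R of e is also an F_{q^m}-space,
-- so |R| = (q^n)^d = (q^m)^d' for its two dimensions d ≤ t ≤ m and d', hence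
-- nd = md', m ∣ d and d = t.  By linear disjointness, F_q-independent vectors
-- with entries in F_{q^n} then stay independent over F_{q^m}, and k vectors
-- independent over F_{q^m} inside U give (q^m)^k distinct elements of U, which
-- has (q^m)^δ elements; so k ≤ δ.

open import Defs
open import Level using (Level; _⊔_)
import Data.Nat as ℕ
open ℕ using (ℕ; zero; suc)
import Data.Nat.Properties as ℕₚ
open import Data.Nat.Divisibility using (_∣_; divides; ∣⇒≤)
open import Data.Nat.GCD using (gcd)
import Data.Nat.Coprimality as Coprimality
open import Data.Fin using (Fin; zero; suc; finToFun; funToFin; punchIn)
import Data.Fin.Properties as Finₚ
open import Data.Fin.Permutation using (Permutation; permutation; _⟨$⟩ʳ_)
import Data.Vec as Vector
open Vector using (_∷_; [])
open import Data.Product using (Σ; _×_; _,_; proj₁; proj₂; ∃-syntax)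
open import Data.Sum using (_⊎_; inj₁; inj₂)
open import Data.Empty using (⊥-elim)
open import Relation.Nullary using (¬_; Dec; yes; no)
open import Relation.Binary.Definitions using (Decidable)
open import Relation.Binary.PropositionalEquality as ≡ using (_≡_; _≗_)
open import Algebra.Bundles using (CommutativeRing)
open import Data.Maybe using (nothing)
open import Tactic.RingSolver using (solve-∀)
open import Tactic.RingSolver.Core.AlmostCommutativeRing
  using (AlmostCommutativeRing; fromCommutativeRing)

^-cancelˡ-≤ : ∀ {N a b} → 1 ℕ.< N → N ℕ.^ a ℕ.≤ N ℕ.^ b → a ℕ.≤ b
^-cancelˡ-≤ {N} {a} {b} 1<N le with a ℕ.≤? b
... | yes a≤b = a≤b
... | no a≰b = ⊥-elim (ℕₚ.<⇒≱ (ℕₚ.^-monoʳ-< N 1<N (ℕₚ.≰⇒> a≰b)) le)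

^-cancelˡ-≡ : ∀ {N a b} → 1 ℕ.< N → N ℕ.^ a ≡ N ℕ.^ b → a ≡ b
^-cancelˡ-≡ 1<N eq = ℕₚ.≤-antisym (^-cancelˡ-≤ 1<N (ℕₚ.≤-reflexive eq))
                                  (^-cancelˡ-≤ 1<N (ℕₚ.≤-reflexive (≡.sym eq)))

-- funToFin respects pointwise equality; with finToFun-funToFin this makes the
-- coding of functions Fin k → Fin N as numbers in Fin (N ^ k) bijective.
funToFin-cong : ∀ {k N} {f g : Fin k → Fin N} → f ≗ g → funToFin f ≡ funToFin g
funToFin-cong {zero} eq = ≡.refl
funToFin-cong {suc k} eq = ≡.cong₂ Data.Fin.combine (eq zero) (funToFin-cong (λ j → eq (suc j)))

-- Equality in a ring enumerated by Fin N is decidable: compare indices.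
module _ {c ℓ} (F : CommutativeRing c ℓ) where
  open CommutativeRing F using (_≈_; sym; trans)

  hasCard⇒decidable : ∀ {N} → HasCard F N → Decidable _≈_
  hasCard⇒decidable card x y with surjective x | surjective y
    where open HasCard card
  ... | i , eᵢ≈x | j , eⱼ≈y with i Finₚ.≟ j
  ...   | yes ≡.refl = yes (trans (sym eᵢ≈x) eⱼ≈y)
  ...   | no i≢j = no (λ x≈y → i≢j (HasCard.injective card i j (trans eᵢ≈x (trans x≈y (sym eⱼ≈y)))))

module FiniteField {c ℓ} (F : CommutativeRing c ℓ) (isField : IsField F)
                   (_≟_ : Decidable (CommutativeRing._≈_ F)) where
  open CommutativeRing F renaming (Carrier to C) hiding (zero)
  open IsField isField
  open import Algebra.Properties.Ring ring using (-‿distribˡ-*; -‿distribʳ-*; -1*x≈-x)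
  open import Algebra.Properties.Group +-group
    using (x∙y⁻¹≈ε⇒x≈y; x≈y⇒x∙y⁻¹≈ε; quasigroup; //-rightDividesˡ; ⁻¹-involutive)
  open import Algebra.Properties.Quasigroup quasigroup using (x≈z//y)
  open import Algebra.Properties.CommutativeSemigroup *-commutativeSemigroup
    using (x∙yz≈y∙xz; xy∙z≈xz∙y)
  open import Algebra.Properties.Semiring.Sum semiring
    using (sum; sum-syntax; sum-cong-≋; ∑-comm; ∑-distrib-+; *-distribˡ-sum; *-distribʳ-sum)
  open import Algebra.Properties.Semiring.Exp semiring using (_^_; ^-congˡ; ^-assocʳ)
  import Algebra.Properties.CommutativeMonoid.Sum *-commutativeMonoid as Product
  open import Relation.Binary.Reasoning.Setoid setoid

  cancel-nonzero : ∀ {x y} → ¬ x ≈ 0# → x * y ≈ 0# → y ≈ 0#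
  cancel-nonzero {x} {y} x≉0 xy≈0 with inverse x x≉0
  ... | z , xz≈1 = begin
    y             ≈⟨ sym (*-identityˡ y) ⟩
    1# * y        ≈⟨ *-congʳ (trans (sym xz≈1) (*-comm x z)) ⟩
    (z * x) * y   ≈⟨ *-assoc z x y ⟩
    z * (x * y)   ≈⟨ *-congˡ xy≈0 ⟩
    z * 0#        ≈⟨ zeroʳ z ⟩
    0#            ∎

  nonzero-* : ∀ {x y} → ¬ x ≈ 0# → ¬ y ≈ 0# → ¬ (x * y) ≈ 0#
  nonzero-* x≉0 y≉0 xy≈0 = y≉0 (cancel-nonzero x≉0 xy≈0)

  solve-+ : ∀ {u x y} → u + y ≈ x → y ≈ x - u
  solve-+ {u} {x} {y} u+y≈x = x≈z//y y u x (trans (+-comm y u) u+y≈x)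

  V : ℕ → Set c
  V = Vec F

  _≈ᵥ_ : ∀ {l} → V l → V l → Set ℓ
  _≈ᵥ_ = _≋_ F

  0ᵥ : ∀ {l} → V l
  0ᵥ = zeroV F

  _+ᵥ_ : ∀ {l} → V l → V l → V l
  _+ᵥ_ = _+V_ F

  _·ᵥ_ : ∀ {l} → C → V l → V l
  _·ᵥ_ = _·V_ F

  lc : ∀ {l k} → (Fin k → C) → (Fin k → V l) → V l
  lc = lincomb F

  ≈ᵥ-sym : ∀ {l} {x y : V l} → x ≈ᵥ y → y ≈ᵥ x
  ≈ᵥ-sym x≈y p = sym (x≈y p)

  ≈ᵥ-trans : ∀ {l} {x y z : V l} → x ≈ᵥ y → y ≈ᵥ z → x ≈ᵥ z
  ≈ᵥ-trans x≈y y≈z p = trans (x≈y p) (y≈z p)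

  lc-at : ∀ {l k} (a : Fin k → C) (v : Fin k → V l) p → lc a v p ≈ ∑[ j < k ] (a j * v j p)
  lc-at {k = zero} a v p = refl
  lc-at {k = suc k} a v p = +-congˡ (lc-at (λ j → a (suc j)) (λ j → v (suc j)) p)

  lc-cong : ∀ {l k} {a b : Fin k → C} {v w : Fin k → V l}
            → (∀ j → a j ≈ b j) → (∀ j → v j ≈ᵥ w j) → lc a v ≈ᵥ lc b w
  lc-cong {k = zero} a≈b v≈w p = refl
  lc-cong {k = suc k} a≈b v≈w p =
    +-cong (*-cong (a≈b zero) (v≈w zero p)) (lc-cong (λ j → a≈b (suc j)) (λ j → v≈w (suc j)) p)

  lc-zero : ∀ {l k} {a : Fin k → C} (v : Fin k → V l) → (∀ j → a j ≈ 0#) → lc a v ≈ᵥ 0ᵥ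
  lc-zero {k = zero} v a≈0 p = refl
  lc-zero {k = suc k} v a≈0 p =
    trans (+-cong (trans (*-congʳ (a≈0 zero)) (zeroˡ _)) (lc-zero (λ j → v (suc j)) (λ j → a≈0 (suc j)) p))
          (+-identityˡ 0#)

  lc-+ : ∀ {l k} (a b : Fin k → C) (v : Fin k → V l) → lc (λ j → a j + b j) v ≈ᵥ (lc a v +ᵥ lc b v)
  lc-+ {k = k} a b v p = begin
    lc (λ j → a j + b j) v p                             ≈⟨ lc-at _ v p ⟩
    ∑[ j < k ] ((a j + b j) * v j p)                     ≈⟨ sum-cong-≋ (λ j → distribʳ (v j p) (a j) (b j)) ⟩
    ∑[ j < k ] (a j * v j p + b j * v j p)               ≈⟨ ∑-distrib-+ (λ j → a j * v j p) (λ j → b j * v j p) ⟩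
    ∑[ j < k ] (a j * v j p) + ∑[ j < k ] (b j * v j p)  ≈⟨ +-cong (lc-at a v p) (lc-at b v p) ⟨
    lc a v p + lc b v p                                  ∎

  lc-*ˡ : ∀ {l k} (x : C) (a : Fin k → C) (v : Fin k → V l) → lc (λ j → x * a j) v ≈ᵥ (x ·ᵥ lc a v)
  lc-*ˡ {k = k} x a v p = begin
    lc (λ j → x * a j) v p            ≈⟨ lc-at _ v p ⟩
    ∑[ j < k ] ((x * a j) * v j p)    ≈⟨ sum-cong-≋ (λ j → *-assoc x (a j) (v j p)) ⟩
    ∑[ j < k ] (x * (a j * v j p))    ≈⟨ *-distribˡ-sum x (λ j → a j * v j p) ⟨
    x * ∑[ j < k ] (a j * v j p)      ≈⟨ *-congˡ (lc-at a v p) ⟨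
    x * lc a v p                      ∎

  lc-sub : ∀ {l k} (a b : Fin k → C) (v : Fin k → V l) p → lc (λ j → a j - b j) v p ≈ lc a v p - lc b v p
  lc-sub a b v p = begin
    lc (λ j → a j - b j) v p               ≈⟨ lc-cong {v = v} (λ j → +-congˡ (sym (-1*x≈-x (b j)))) (λ j p → refl) p ⟩
    lc (λ j → a j + - 1# * b j) v p        ≈⟨ lc-+ a _ v p ⟩
    lc a v p + lc (λ j → - 1# * b j) v p   ≈⟨ +-congˡ (trans (lc-*ˡ (- 1#) b v p) (-1*x≈-x _)) ⟩
    lc a v p - lc b v p                    ∎

  lc-scale-vectors : ∀ {l k} (y : C) (a : Fin k → C) (v : Fin k → V l)
                     → (y ·ᵥ lc a v) ≈ᵥ lc a (λ j → y ·ᵥ v j)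
  lc-scale-vectors {k = k} y a v p = begin
    y * lc a v p                     ≈⟨ *-congˡ (lc-at a v p) ⟩
    y * ∑[ j < k ] (a j * v j p)     ≈⟨ *-distribˡ-sum y (λ j → a j * v j p) ⟩
    ∑[ j < k ] (y * (a j * v j p))   ≈⟨ sum-cong-≋ (λ j → x∙yz≈y∙xz y (a j) (v j p)) ⟩
    ∑[ j < k ] (a j * (y * v j p))   ≈⟨ lc-at a (λ j → y ·ᵥ v j) p ⟨
    lc a (λ j → y ·ᵥ v j) p          ∎

  record LinearlyClosed (K : C → Set ℓ) {l p} (P : V l → Set p) : Set (c ⊔ ℓ ⊔ p) where
    field
      resp  : ∀ {u v} → u ≈ᵥ v → P u → P v
      has-0 : P 0ᵥ
      add   : ∀ {u v} → P u → P v → P (u +ᵥ v)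
      scale : ∀ {a u} → K a → P u → P (a ·ᵥ u)

  lc-closed : ∀ {K : C → Set ℓ} {l p} {P : V l → Set p} → LinearlyClosed K P
              → ∀ {k} {a : Fin k → C} {v : Fin k → V l}
              → (∀ j → K (a j)) → (∀ j → P (v j)) → P (lc a v)
  lc-closed P-closed {zero} Ka Pv = LinearlyClosed.has-0 P-closed
  lc-closed P-closed {suc k} Ka Pv =
    LinearlyClosed.add P-closed (LinearlyClosed.scale P-closed (Ka zero) (Pv zero))
                                (lc-closed P-closed (λ j → Ka (suc j)) (λ j → Pv (suc j)))

  subspace⇒closed : ∀ {K : C → Set ℓ} {l} {U : V l → Set ℓ} → IsSubspace F K U → LinearlyClosed K U
  subspace⇒closed U-sub = record
    { resp = resp ; has-0 = has-0 ; add = closed-+ ; scale = closed-· }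
    where open IsSubspace U-sub

  InSpan : (K : C → Set ℓ) → ∀ {l k} → (Fin k → V l) → V l → Set (c ⊔ ℓ)
  InSpan K {k = k} w x = Σ (Fin k → C) (λ a → (∀ j → K (a j)) × (lc a w ≈ᵥ x))

  span-nonzero⇒nonempty : ∀ {K : C → Set ℓ} {l d} (b : Fin d → V l) {x}
                          → InSpan K b x → ¬ x ≈ᵥ 0ᵥ → 0 ℕ.< d
  span-nonzero⇒nonempty {d = zero} b (a , _ , eq) x≉0 = ⊥-elim (x≉0 (≈ᵥ-sym eq))
  span-nonzero⇒nonempty {d = suc d} b _ _ = ℕ.s≤s ℕ.z≤n

  module Subfield {K : C → Set ℓ} {N : ℕ} (K-sub : IsSubfieldOfOrder F K N) where
    open IsSubfieldOfOrder K-sub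
      using (has-0; has-1; closed-+; closed-neg; closed-*; closed-inv)
      renaming (enum to elem; enum-in to elem∈K; injective to elem-injective; surjective to elem-surjective)

    unitCoeff : ∀ {k} → Fin k → Fin k → C
    unitCoeff zero zero = 1#
    unitCoeff zero (suc j) = 0#
    unitCoeff (suc i) zero = 0#
    unitCoeff (suc i) (suc j) = unitCoeff i j

    unitCoeff∈K : ∀ {k} (i j : Fin k) → K (unitCoeff i j)
    unitCoeff∈K zero zero = has-1
    unitCoeff∈K zero (suc j) = has-0
    unitCoeff∈K (suc i) zero = has-0
    unitCoeff∈K (suc i) (suc j) = unitCoeff∈K i j

    lc-unitCoeff : ∀ {l k} (i : Fin k) (w : Fin k → V l) → lc (unitCoeff i) w ≈ᵥ w i
    lc-unitCoeff {k = suc k} zero w p =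
      trans (+-cong (*-identityˡ _) (lc-zero (λ j → w (suc j)) (λ j → refl) p)) (+-identityʳ _)
    lc-unitCoeff {k = suc k} (suc i) w p =
      trans (+-cong (zeroˡ _) (lc-unitCoeff i (λ j → w (suc j)) p)) (+-identityˡ _)

    span-closed : ∀ {l k} (w : Fin k → V l) → LinearlyClosed K (InSpan K w)
    span-closed w = record
      { resp  = λ { u≈v (a , Ka , eq) → a , Ka , ≈ᵥ-trans eq u≈v }
      ; has-0 = (λ _ → 0#) , (λ _ → has-0) , lc-zero w (λ _ → refl)
      ; add   = λ { (a , Ka , ea) (b , Kb , eb) →
                    (λ j → a j + b j) , (λ j → closed-+ (Ka j) (Kb j)) ,
                    ≈ᵥ-trans (lc-+ a b w) (λ p → +-cong (ea p) (eb p)) }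
      ; scale = λ { {x} Kx (a , Ka , ea) →
                    (λ j → x * a j) , (λ j → closed-* Kx (Ka j)) ,
                    ≈ᵥ-trans (lc-*ˡ x a w) (λ p → *-congˡ (ea p)) }
      }

    span-gen : ∀ {l k} (w : Fin k → V l) i → InSpan K w (w i)
    span-gen w i = unitCoeff i , unitCoeff∈K i , lc-unitCoeff i w

    span-mono : ∀ {l k d} {w : Fin k → V l} {b : Fin d → V l}
                → (∀ i → InSpan K b (w i)) → ∀ {x} → InSpan K w x → InSpan K b x
    span-mono {b = b} w⊆b (a , Ka , eq) =
      LinearlyClosed.resp (span-closed b) eq (lc-closed (span-closed b) Ka w⊆b)

    span-tail : ∀ {l k} {w : Fin (suc k) → V l} {x} → InSpan K (λ j → w (suc j)) x → InSpan K w x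
    span-tail (a , Ka , eq) =
      (λ { zero → 0# ; (suc j) → a j }) , (λ { zero → has-0 ; (suc j) → Ka j }) ,
      λ p → trans (+-cong (zeroˡ _) (eq p)) (+-identityˡ _)

    -- Membership in a span is decidable: try every first coefficient in K.
    span? : ∀ {l k} (w : Fin k → V l) x → Dec (InSpan K w x)
    span? {k = zero} w x with Finₚ.all? (λ p → 0# ≟ x p)
    ... | yes 0≈x = yes ((λ ()) , (λ ()) , 0≈x)
    ... | no 0≉x = no (λ { (a , Ka , eq) → 0≉x eq })
    span? {k = suc k} w x
      with Finₚ.any? (λ i → span? (λ j → w (suc j)) (λ p → x p - elem i * w zero p))
    ... | yes (i , a , Ka , eq) =
      yes ((λ { zero → elem i ; (suc j) → a j }) , (λ { zero → elem∈K i ; (suc j) → Ka j }) ,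
           λ p → trans (+-congˡ (eq p)) (trans (+-comm _ _) (//-rightDividesˡ _ (x p))))
    ... | no none = no λ { (a , Ka , eq) →
      let (i , eᵢ≈a₀) = elem-surjective (a zero) (Ka zero) in
      none (i , (λ j → a (suc j)) , (λ j → Ka (suc j)) ,
            λ p → trans (solve-+ (eq p)) (+-congˡ (-‿cong (*-congʳ (sym eᵢ≈a₀))))) }

    -- Prepending a vector outside the span of an independent family keeps it
    -- independent: a nonzero first coefficient would express v₀ by the others.
    independent-cons : ∀ {l d} (v : Fin (suc d) → V l) → LinIndep F K (λ j → v (suc j))
                       → ¬ InSpan K (λ j → v (suc j)) (v zero) → LinIndep F K v
    independent-cons v tail-indep v₀∉span a Ka sum≈0 with a zero ≟ 0#
    ... | yes a₀≈0 = λ { zero → a₀≈0 ; (suc j) → tail-indep _ (λ j → Ka (suc j)) tail≈0 j }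
      where
      tail≈0 : lc (λ j → a (suc j)) (λ j → v (suc j)) ≈ᵥ 0ᵥ
      tail≈0 p = trans (sym (+-identityˡ _))
                       (trans (+-congʳ (sym (trans (*-congʳ a₀≈0) (zeroˡ _)))) (sum≈0 p))
    ... | no a₀≉0 with inverse (a zero) a₀≉0
    ...   | z , a₀z≈1 = ⊥-elim (v₀∉span ((λ j → - z * a (suc j)) ,
              (λ j → closed-* (closed-neg (closed-inv (Ka zero) a₀z≈1)) (Ka (suc j))) , v₀≈))
      where
      v₀≈ : lc (λ j → - z * a (suc j)) (λ j → v (suc j)) ≈ᵥ v zero
      v₀≈ p = begin
        lc (λ j → - z * a (suc j)) (λ j → v (suc j)) p ≈⟨ lc-*ˡ (- z) (λ j → a (suc j)) (λ j → v (suc j)) p ⟩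
        - z * lc (λ j → a (suc j)) (λ j → v (suc j)) p ≈⟨ *-congˡ (trans (solve-+ (sum≈0 p)) (+-identityˡ _)) ⟩
        - z * - (a zero * v zero p)                     ≈⟨ -‿distribʳ-* (- z) _ ⟨
        - (- z * (a zero * v zero p))                   ≈⟨ -‿cong (-‿distribˡ-* z _) ⟨
        - - (z * (a zero * v zero p))                   ≈⟨ ⁻¹-involutive _ ⟩
        z * (a zero * v zero p)                         ≈⟨ *-assoc _ _ _ ⟨
        (z * a zero) * v zero p                         ≈⟨ *-congʳ (trans (*-comm z _) a₀z≈1) ⟩
        1# * v zero p                                   ≈⟨ *-identityˡ _ ⟩
        v zero p                                        ∎

    record Basis {l t} (w : Fin t → V l) : Set (c ⊔ ℓ) where
      field
        d           : ℕ
        b           : Fin d → V l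
        independent : LinIndep F K b
        b⊆span-w    : ∀ j → InSpan K w (b j)
        w⊆span-b    : ∀ i → InSpan K b (w i)
        d≤t         : d ℕ.≤ t
        shorter-or-independent : (d ℕ.< t) ⊎ LinIndep F K w

    basis : ∀ {l t} (w : Fin t → V l) → Basis w
    basis {t = zero} w = record
      { d = 0 ; b = w ; independent = λ a Ka eq () ; b⊆span-w = λ () ; w⊆span-b = λ ()
      ; d≤t = ℕ.z≤n ; shorter-or-independent = inj₂ (λ a Ka eq ()) }
    basis {l} {t = suc t} w with basis (λ j → w (suc j))
    ... | B with span? (Basis.b B) (w zero)
    ...   | yes w₀∈ = record
      { d = d ; b = b ; independent = independent
      ; b⊆span-w = λ j → span-tail {w = w} (b⊆span-w j)
      ; w⊆span-b = λ { zero → w₀∈ ; (suc i) → w⊆span-b i }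
      ; d≤t = ℕₚ.m≤n⇒m≤1+n d≤t
      ; shorter-or-independent = inj₁ (ℕ.s≤s d≤t) }
      where open Basis B
    ...   | no w₀∉ = record
      { d = suc d ; b = b′
      ; independent = independent-cons b′ independent w₀∉
      ; b⊆span-w = λ { zero → span-gen w zero ; (suc j) → span-tail {w = w} (b⊆span-w j) }
      ; w⊆span-b = λ { zero → span-gen b′ zero ; (suc i) → span-tail {w = b′} (w⊆span-b i) }
      ; d≤t = ℕ.s≤s d≤t
      ; shorter-or-independent = extend shorter-or-independent }
      where
      open Basis B
      b′ : Fin (suc d) → V l
      b′ zero = w zero
      b′ (suc j) = b j
      extend : (d ℕ.< t) ⊎ LinIndep F K (λ j → w (suc j)) → (suc d ℕ.< suc t) ⊎ LinIndep F K w
      extend (inj₁ d<t) = inj₁ (ℕ.s≤s d<t)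
      extend (inj₂ tail-indep) = inj₂ (independent-cons w tail-indep (λ w₀∈ → w₀∉ (span-mono w⊆span-b w₀∈)))

    -- The K-combinations of k vectors are indexed by Fin (N ^ k), reading an
    -- index as the tuple of (indices in K of) its coefficients.
    coeff : ∀ k → Fin (N ℕ.^ k) → Fin k → C
    coeff k i j = elem (finToFun {N} {k} i j)

    coeff∈K : ∀ k (i : Fin (N ℕ.^ k)) j → K (coeff k i j)
    coeff∈K k i j = elem∈K (finToFun {N} {k} i j)

    comb : ∀ {l k} → (Fin k → V l) → Fin (N ℕ.^ k) → V l
    comb {k = k} w i = lc (coeff k i) w

    comb-surjective : ∀ {l k} (w : Fin k → V l) {x} → InSpan K w x → ∃[ i ] (comb w i ≈ᵥ x)
    comb-surjective {k = k} w (a , Ka , eq) = funToFin index , ≈ᵥ-trans (lc-cong coeff≈a (λ j p → refl)) eq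
      where
      index : Fin k → Fin N
      index j = proj₁ (elem-surjective (a j) (Ka j))
      coeff≈a : ∀ j → coeff k (funToFin index) j ≈ a j
      coeff≈a j = trans (reflexive (≡.cong elem (Finₚ.finToFun-funToFin index j)))
                        (proj₂ (elem-surjective (a j) (Ka j)))

    comb-injective : ∀ {l k} (u : Fin k → V l) → LinIndep F K u
                     → ∀ i i′ → comb u i ≈ᵥ comb u i′ → i ≡ i′
    comb-injective {k = k} u u-indep i i′ eq =
      ≡.trans (≡.sym (Finₚ.funToFin-finToFin {k} {N} i))
              (≡.trans (funToFin-cong (λ j → elem-injective _ _ (coeff≈ j)))
                       (Finₚ.funToFin-finToFin {k} {N} i′))
      where
      diff≈0 : lc (λ j → coeff k i j - coeff k i′ j) u ≈ᵥ 0ᵥ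
      diff≈0 p = trans (lc-sub (coeff k i) (coeff k i′) u p) (x≈y⇒x∙y⁻¹≈ε (eq p))
      coeff≈ : ∀ j → coeff k i j ≈ coeff k i′ j
      coeff≈ j = x∙y⁻¹≈ε⇒x≈y _ _
        (u-indep _ (λ j → closed-+ (coeff∈K k i j) (closed-neg (coeff∈K k i′ j))) diff≈0 j)

    span-card : ∀ {l d M} (w : Fin d → V l) (s : Fin M → V l) → (∀ i i′ → s i ≈ᵥ s i′ → i ≡ i′)
                → (∀ i → InSpan K w (s i)) → M ℕ.≤ N ℕ.^ d
    span-card {d = d} {M} w s s-injective s∈span = Finₚ.injective⇒≤ {f = index} index-injective
      where
      index : Fin M → Fin (N ℕ.^ d)
      index i = proj₁ (comb-surjective w (s∈span i))
      index-injective : ∀ {i i′} → index i ≡ index i′ → i ≡ i′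
      index-injective {i} {i′} eq = s-injective i i′ (λ p →
        trans (sym (proj₂ (comb-surjective w (s∈span i)) p))
              (trans (reflexive (≡.cong (λ z → comb w z p) eq)) (proj₂ (comb-surjective w (s∈span i′)) p)))

  card-bound : ∀ {K K′ : C → Set ℓ} {N N′ l k d}
               → IsSubfieldOfOrder F K N → IsSubfieldOfOrder F K′ N′
               → (u : Fin k → V l) (w : Fin d → V l) → LinIndep F K u
               → (∀ a → (∀ j → K (a j)) → InSpan K′ w (lc a u))
               → N ℕ.^ k ℕ.≤ N′ ℕ.^ d
  card-bound {k = k} K-sub K′-sub u w u-indep span⊆ =
    Subfield.span-card K′-sub w (Subfield.comb K-sub u) (Subfield.comb-injective K-sub u u-indep)
      (λ i → span⊆ (Subfield.coeff K-sub k i) (Subfield.coeff∈K K-sub k i))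

  -- A subfield contains 0 ≉ 1, so it has at least two elements.
  subfield-card>1 : ∀ {S : C → Set ℓ} {N} → IsSubfieldOfOrder F S N → 1 ℕ.< N
  subfield-card>1 S-sub with surjective 0# has-0 | surjective 1# has-1
    where open IsSubfieldOfOrder S-sub
  ... | i₀ , e₀ | i₁ , e₁ = distinct⇒1< i₀ i₁ (λ i₀≡i₁ →
          1≉0 (trans (sym e₁) (trans (reflexive (≡.cong enum (≡.sym i₀≡i₁))) e₀)))
    where
    open IsSubfieldOfOrder S-sub
    distinct⇒1< : ∀ {M} (i j : Fin M) → ¬ i ≡ j → 1 ℕ.< M
    distinct⇒1< {suc zero} zero zero i≢j = ⊥-elim (i≢j ≡.refl)
    distinct⇒1< {suc (suc M)} _ _ _ = ℕ.s≤s (ℕ.s≤s ℕ.z≤n)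

  ∏ : ∀ {n} → (Fin n → C) → C
  ∏ = Product.sum

  product-nonzero : ∀ {n} (f : Fin n → C) → (∀ i → ¬ f i ≈ 0#) → ¬ ∏ f ≈ 0#
  product-nonzero {zero} f f≉0 = 1≉0
  product-nonzero {suc n} f f≉0 = nonzero-* (f≉0 zero) (product-nonzero (λ i → f (suc i)) (λ i → f≉0 (suc i)))

  product-except : ∀ {n} (g h : Fin n → C) (z : Fin n) (c : C)
                   → (∀ i → ¬ i ≡ z → g i ≈ h i) → g z ≈ c * h z → ∏ g ≈ c * ∏ h
  product-except {suc n} g h z c g≈h gz≈ch = begin
    ∏ g                                     ≈⟨ Product.sum-remove {i = z} g ⟩
    g z * ∏ (λ i → g (punchIn z i))         ≈⟨ *-cong gz≈ch (Product.sum-cong-≋ (λ i → g≈h _ (Finₚ.punchInᵢ≢i z i))) ⟩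
    c * h z * ∏ (λ i → h (punchIn z i))     ≈⟨ *-assoc c _ _ ⟩
    c * (h z * ∏ (λ i → h (punchIn z i)))   ≈⟨ *-congˡ (Product.sum-remove {i = z} h) ⟨
    c * ∏ h                                 ∎

  cancelʳ-nonzero : ∀ {a b y} → ¬ y ≈ 0# → a * y ≈ b * y → a ≈ b
  cancelʳ-nonzero {a} {b} {y} y≉0 ay≈by = x∙y⁻¹≈ε⇒x≈y a b (cancel-nonzero y≉0 (begin
    y * (a - b)       ≈⟨ *-comm y _ ⟩
    (a - b) * y       ≈⟨ distribʳ y a (- b) ⟩
    a * y + - b * y   ≈⟨ +-congˡ (-‿distribˡ-* b y) ⟨
    a * y - b * y     ≈⟨ x≈y⇒x∙y⁻¹≈ε ay≈by ⟩
    0#                ∎))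

  -- y with 0 replaced by 1: a nonzero stand-in used to make products invertible.
  nonzeroPart : C → C
  nonzeroPart y with y ≟ 0#
  ... | yes _ = 1#
  ... | no _ = y

  nonzeroPart≉0 : ∀ y → ¬ nonzeroPart y ≈ 0#
  nonzeroPart≉0 y with y ≟ 0#
  ... | yes _ = 1≉0
  ... | no y≉0 = y≉0

  nonzeroPart-0 : ∀ {y} → y ≈ 0# → nonzeroPart y ≈ 1#
  nonzeroPart-0 {y} y≈0 with y ≟ 0#
  ... | yes _ = refl
  ... | no y≉0 = ⊥-elim (y≉0 y≈0)

  nonzeroPart-≉0 : ∀ {y} → ¬ y ≈ 0# → nonzeroPart y ≈ y
  nonzeroPart-≉0 {y} y≉0 with y ≟ 0#
  ... | yes y≈0 = ⊥-elim (y≉0 y≈0)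
  ... | no _ = refl

  module Lagrange {S : C → Set ℓ} {N : ℕ} (S-sub : IsSubfieldOfOrder F S N) where
    open IsSubfieldOfOrder S-sub

    scaleIndex : ∀ {x} → S x → Fin N → Fin N
    scaleIndex {x} Sx i = proj₁ (surjective (x * enum i) (closed-* Sx (enum-in i)))

    enum-scaleIndex : ∀ {x} (Sx : S x) i → enum (scaleIndex Sx i) ≈ x * enum i
    enum-scaleIndex {x} Sx i = proj₂ (surjective (x * enum i) (closed-* Sx (enum-in i)))

    scaleIndex-inverse : ∀ {x z} (Sx : S x) (Sz : S z) → x * z ≈ 1# → ∀ i → scaleIndex Sx (scaleIndex Sz i) ≡ i
    scaleIndex-inverse {x} {z} Sx Sz xz≈1 i = injective _ i (begin
      enum (scaleIndex Sx (scaleIndex Sz i)) ≈⟨ enum-scaleIndex Sx _ ⟩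
      x * enum (scaleIndex Sz i)             ≈⟨ *-congˡ (enum-scaleIndex Sz i) ⟩
      x * (z * enum i)                       ≈⟨ *-assoc x z _ ⟨
      (x * z) * enum i                       ≈⟨ *-congʳ xz≈1 ⟩
      1# * enum i                            ≈⟨ *-identityˡ _ ⟩
      enum i                                 ∎)

    scale-permutation : ∀ {x} → S x → ¬ x ≈ 0# → Permutation N N
    scale-permutation {x} Sx x≉0 with inverse x x≉0
    ... | z , xz≈1 = permutation (scaleIndex Sx) (scaleIndex Sz) (scaleIndex-inverse Sx Sz xz≈1)
                                 (scaleIndex-inverse Sz Sx (trans (*-comm z x) xz≈1))
      where
      Sz : S z
      Sz = closed-inv Sx xz≈1

    -- With P = ∏ nonzeroPart(s) over s ∈ S, permuting by x gives x^N · P ≈ x · P.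
    lagrange : ∀ x → S x → x ^ N ≈ x
    lagrange x Sx with x ≟ 0# | subfield-card>1 S-sub
    ... | yes x≈0 | ℕ.s≤s _ = trans (*-congʳ x≈0) (trans (zeroˡ _) (sym x≈0))
    ... | no x≉0 | _ = cancelʳ-nonzero (product-nonzero f (λ i → nonzeroPart≉0 _)) (begin
      x ^ N * ∏ f                 ≈⟨ *-congʳ (Product.sum-replicate N {x}) ⟨
      ∏ {N} (λ _ → x) * ∏ f       ≈⟨ Product.∑-distrib-+ (λ _ → x) f ⟨
      ∏ (λ i → x * f i)           ≈⟨ product-except (λ i → x * f i) f∘π i₀ x off-zero at-zero ⟩
      x * ∏ f∘π                   ≈⟨ *-congˡ (sym (Product.sum-permute f π)) ⟩
      x * ∏ f                     ∎)
      where
      f : Fin N → C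
      f i = nonzeroPart (enum i)
      π : Permutation N N
      π = scale-permutation Sx x≉0
      f∘π : Fin N → C
      f∘π i = f (π ⟨$⟩ʳ i)
      i₀ : Fin N
      i₀ = proj₁ (surjective 0# has-0)
      e₀≈0 : enum i₀ ≈ 0#
      e₀≈0 = proj₂ (surjective 0# has-0)
      off-zero : ∀ i → ¬ i ≡ i₀ → x * f i ≈ f∘π i
      off-zero i i≢i₀ = begin
        x * nonzeroPart (enum i)   ≈⟨ *-congˡ (nonzeroPart-≉0 eᵢ≉0) ⟩
        x * enum i                 ≈⟨ enum-scaleIndex Sx i ⟨
        enum (π ⟨$⟩ʳ i)            ≈⟨ nonzeroPart-≉0 eπᵢ≉0 ⟨
        f∘π i                      ∎
        where
        eᵢ≉0 : ¬ enum i ≈ 0#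
        eᵢ≉0 eᵢ≈0 = i≢i₀ (injective i i₀ (trans eᵢ≈0 (sym e₀≈0)))
        eπᵢ≉0 : ¬ enum (π ⟨$⟩ʳ i) ≈ 0#
        eπᵢ≉0 eπᵢ≈0 = nonzero-* x≉0 eᵢ≉0 (trans (sym (enum-scaleIndex Sx i)) eπᵢ≈0)
      at-zero : x * f i₀ ≈ x * f∘π i₀
      at-zero = *-congˡ (trans (nonzeroPart-0 e₀≈0)
                  (sym (nonzeroPart-0 (trans (enum-scaleIndex Sx i₀) (trans (*-congˡ e₀≈0) (zeroʳ x))))))

  -- Polynomials over F as coefficient vectors (constant term first),
  -- evaluated by Horner's rule.
  eval : ∀ {n} → Vector.Vec C n → C → C
  eval [] x = 0#
  eval (a ∷ as) x = a + x * eval as x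

  divideBy : C → ∀ {n} → Vector.Vec C (suc n) → Vector.Vec C n
  divideBy r (a ∷ []) = []
  divideBy r (a ∷ b ∷ bs) = eval (b ∷ bs) r ∷ divideBy r (b ∷ bs)

  -- The induction step of the remainder theorem, with b standing for - r
  -- (the solver cannot cancel - r + r itself, having no zero test).
  private
    ACR : AlmostCommutativeRing c ℓ
    ACR = fromCommutativeRing F (λ _ → nothing)
    module A = AlmostCommutativeRing ACR

    horner-identity : ∀ x b r a ρ Q →
      A._≈_ ((a A.+ x A.* ((x A.+ b) A.* Q A.+ ρ)) A.+ (b A.+ r) A.* ρ)
            ((x A.+ b) A.* (ρ A.+ x A.* Q) A.+ (a A.+ r A.* ρ))
    horner-identity = solve-∀ ACR

  remainder-theorem : ∀ {n} (p : Vector.Vec C (suc n)) x r → eval p x ≈ (x - r) * eval (divideBy r p) x + eval p r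
  remainder-theorem (a ∷ []) x r = begin
    a + x * 0#                   ≈⟨ +-congˡ (zeroʳ x) ⟩
    a + 0#                       ≈⟨ +-congˡ (zeroʳ r) ⟨
    a + r * 0#                   ≈⟨ +-identityˡ _ ⟨
    0# + (a + r * 0#)            ≈⟨ +-congʳ (zeroʳ (x - r)) ⟨
    (x - r) * 0# + (a + r * 0#)  ∎
  remainder-theorem (a ∷ d ∷ ds) x r = begin
    a + x * eval (d ∷ ds) x                            ≈⟨ +-congˡ (*-congˡ (remainder-theorem (d ∷ ds) x r)) ⟩
    a + x * ((x - r) * Q + ρ)                          ≈⟨ +-identityʳ _ ⟨
    a + x * ((x - r) * Q + ρ) + 0#                     ≈⟨ +-congˡ (trans (*-congʳ (-‿inverseˡ r)) (zeroˡ ρ)) ⟨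
    a + x * ((x - r) * Q + ρ) + (- r + r) * ρ          ≈⟨ horner-identity x (- r) r a ρ Q ⟩
    (x - r) * (ρ + x * Q) + (a + r * ρ)                ∎
    where
    ρ Q : C
    ρ = eval (d ∷ ds) r
    Q = eval (divideBy r (d ∷ ds)) x

  zero-quotient⇒zero : ∀ {n} r (p : Vector.Vec C (suc n)) → (∀ i → Vector.lookup (divideBy r p) i ≈ 0#)
                       → eval p r ≈ 0# → ∀ i → Vector.lookup p i ≈ 0#
  zero-quotient⇒zero r (a ∷ []) q≈0 p[r]≈0 zero =
    trans (sym (trans (+-congˡ (zeroʳ r)) (+-identityʳ a))) p[r]≈0
  zero-quotient⇒zero r (a ∷ d ∷ ds) q≈0 p[r]≈0 zero =
    trans (sym (trans (+-congˡ (trans (*-congˡ (q≈0 zero)) (zeroʳ r))) (+-identityʳ a))) p[r]≈0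
  zero-quotient⇒zero r (a ∷ d ∷ ds) q≈0 p[r]≈0 (suc i) =
    zero-quotient⇒zero r (d ∷ ds) (λ j → q≈0 (suc j)) (q≈0 zero) i

  roots⇒zero : ∀ {D} (p : Vector.Vec C (suc D)) (r : Fin (suc D) → C) → (∀ i j → r i ≈ r j → i ≡ j)
               → (∀ i → eval p (r i) ≈ 0#) → ∀ i → Vector.lookup p i ≈ 0#
  roots⇒zero {zero} p r r-inj roots = zero-quotient⇒zero (r zero) p (λ ()) (roots zero)
  roots⇒zero {suc D} p r r-inj roots =
    zero-quotient⇒zero r₀ p
      (roots⇒zero (divideBy r₀ p) (λ i → r (suc i)) (λ i j eq → Finₚ.suc-injective (r-inj _ _ eq)) quotient-roots)
      (roots zero)
    where
    r₀ : C
    r₀ = r zero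
    quotient-roots : ∀ i → eval (divideBy r₀ p) (r (suc i)) ≈ 0#
    quotient-roots i = cancel-nonzero rᵢ-r₀≉0 (begin
      (rᵢ - r₀) * eval (divideBy r₀ p) rᵢ                ≈⟨ +-identityʳ _ ⟨
      (rᵢ - r₀) * eval (divideBy r₀ p) rᵢ + 0#           ≈⟨ +-congˡ (roots zero) ⟨
      (rᵢ - r₀) * eval (divideBy r₀ p) rᵢ + eval p r₀    ≈⟨ remainder-theorem p rᵢ r₀ ⟨
      eval p rᵢ                                          ≈⟨ roots (suc i) ⟩
      0#                                                 ∎)
      where
      rᵢ : C
      rᵢ = r (suc i)
      rᵢ-r₀≉0 : ¬ (rᵢ - r₀) ≈ 0#
      rᵢ-r₀≉0 eq with r-inj _ _ (x∙y⁻¹≈ε⇒x≈y _ _ eq)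
      ... | ()

  monomial : ∀ k → Vector.Vec C (suc k)
  monomial zero = 1# ∷ []
  monomial (suc k) = 0# ∷ monomial k

  eval-monomial : ∀ k x → eval (monomial k) x ≈ x ^ k
  eval-monomial zero x = trans (+-congˡ (zeroʳ x)) (+-identityʳ _)
  eval-monomial (suc k) x = trans (+-identityˡ _) (*-congˡ (eval-monomial k x))

  monomial-leading : ∀ k → Vector.lookup (monomial k) (Data.Fin.fromℕ k) ≡ 1#
  monomial-leading zero = ≡.refl
  monomial-leading (suc k) = monomial-leading k

  frobeniusPoly : ∀ k → Vector.Vec C (3 ℕ.+ k)
  frobeniusPoly k = 0# ∷ - 1# ∷ monomial k

  eval-frobeniusPoly : ∀ k x → eval (frobeniusPoly k) x ≈ x ^ (2 ℕ.+ k) - x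
  eval-frobeniusPoly k x = begin
    0# + x * (- 1# + x * eval (monomial k) x)     ≈⟨ +-identityˡ _ ⟩
    x * (- 1# + x * eval (monomial k) x)          ≈⟨ distribˡ x _ _ ⟩
    x * - 1# + x * (x * eval (monomial k) x)      ≈⟨ +-cong x*-1≈-x (*-congˡ (*-congˡ (eval-monomial k x))) ⟩
    - x + x ^ (2 ℕ.+ k)                           ≈⟨ +-comm _ _ ⟩
    x ^ (2 ℕ.+ k) - x                             ∎
    where
    x*-1≈-x : x * - 1# ≈ - x
    x*-1≈-x = trans (*-comm x _) (-1*x≈-x x)

  -- The subfield T of order M contains every root of X^M - X in F: its own M
  -- elements are roots (Lagrange), and X^M - X has at most M roots.
  root⇒∈subfield : ∀ {T : C → Set ℓ} {M} → IsSubfieldOfOrder F T M → ∀ x → x ^ M ≈ x → T x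
  root⇒∈subfield T-sub x xᴹ≈x with Finₚ.any? (λ i → enum i ≟ x) | subfield-card>1 T-sub
    where open IsSubfieldOfOrder T-sub
  ... | yes (i , eᵢ≈x) | _ = resp eᵢ≈x (enum-in i)
    where open IsSubfieldOfOrder T-sub
  ... | no x∉T | ℕ.s≤s (ℕ.s≤s {n = k} _) =
    ⊥-elim (1≉0 (trans (reflexive (≡.sym (monomial-leading k)))
                       (roots⇒zero (frobeniusPoly k) r r-injective r-roots (suc (suc (Data.Fin.fromℕ k))))))
    where
    open IsSubfieldOfOrder T-sub
    open Lagrange T-sub using (lagrange)
    r : Fin (suc (2 ℕ.+ k)) → C
    r zero = x
    r (suc i) = enum i
    r-injective : ∀ i j → r i ≈ r j → i ≡ j
    r-injective zero zero eq = ≡.refl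
    r-injective zero (suc j) eq = ⊥-elim (x∉T (j , sym eq))
    r-injective (suc i) zero eq = ⊥-elim (x∉T (i , eq))
    r-injective (suc i) (suc j) eq = ≡.cong suc (injective i j eq)
    r-roots : ∀ i → eval (frobeniusPoly k) (r i) ≈ 0#
    r-roots zero = trans (eval-frobeniusPoly k x) (x≈y⇒x∙y⁻¹≈ε xᴹ≈x)
    r-roots (suc i) = trans (eval-frobeniusPoly k _) (x≈y⇒x∙y⁻¹≈ε (lagrange (enum i) (enum-in i)))

  ^-fixed-iterate : ∀ x q → x ^ q ≈ x → ∀ m → x ^ (q ℕ.^ m) ≈ x
  ^-fixed-iterate x q xᵠ≈x zero = *-identityʳ x
  ^-fixed-iterate x q xᵠ≈x (suc m) = begin
    x ^ (q ℕ.* q ℕ.^ m)   ≈⟨ ^-assocʳ x q (q ℕ.^ m) ⟨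
    (x ^ q) ^ (q ℕ.^ m)   ≈⟨ ^-congˡ (q ℕ.^ m) xᵠ≈x ⟩
    x ^ (q ℕ.^ m)         ≈⟨ ^-fixed-iterate x q xᵠ≈x m ⟩
    x                     ∎

  subfield-⊆ : ∀ {S T : C → Set ℓ} {q} m → IsSubfieldOfOrder F S q → IsSubfieldOfOrder F T (q ℕ.^ m)
               → ∀ {x} → S x → T x
  subfield-⊆ {q = q} m S-sub T-sub {x} Sx =
    root⇒∈subfield T-sub x (^-fixed-iterate x q (Lagrange.lagrange S-sub x Sx) m)

  coordinates-closed : ∀ {K M : C → Set ℓ} {N l} → IsSubfieldOfOrder F M N → (∀ {x} → K x → M x)
                       → LinearlyClosed K (λ (y : V l) → ∀ p → M (y p))
  coordinates-closed M-sub K⊆M = record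
    { resp  = λ u≈v u∈ p → resp (u≈v p) (u∈ p)
    ; has-0 = λ p → has-0
    ; add   = λ u∈ v∈ p → closed-+ (u∈ p) (v∈ p)
    ; scale = λ Ka u∈ p → closed-* (K⊆M Ka) (u∈ p) }
    where open IsSubfieldOfOrder M-sub

  -- Scalars as vectors of F^1, so that spans of scalars are spans of vectors.
  ⟨_⟩ : C → V 1
  ⟨ x ⟩ _ = x

  sum-exchange : ∀ {k t} (a : Fin k → Fin t → C) (x : Fin k → C) (y : Fin t → C)
                 → ∑[ i < t ] (∑[ j < k ] (a j i * x j) * y i) ≈ ∑[ j < k ] (∑[ i < t ] (a j i * y i) * x j)
  sum-exchange {k} {t} a x y = begin
    ∑[ i < t ] (∑[ j < k ] (a j i * x j) * y i)   ≈⟨ sum-cong-≋ (λ i → *-distribʳ-sum (y i) (λ j → a j i * x j)) ⟩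
    ∑[ i < t ] ∑[ j < k ] (a j i * x j * y i)     ≈⟨ ∑-comm (λ i j → a j i * x j * y i) ⟩
    ∑[ j < k ] ∑[ i < t ] (a j i * x j * y i)     ≈⟨ sum-cong-≋ (λ j → sum-cong-≋ (λ i → xy∙z≈xz∙y (a j i) (x j) (y i))) ⟩
    ∑[ j < k ] ∑[ i < t ] (a j i * y i * x j)     ≈⟨ sum-cong-≋ (λ j → *-distribʳ-sum (x j) (λ i → a j i * y i)) ⟨
    ∑[ j < k ] (∑[ i < t ] (a j i * y i) * x j)   ∎

  -- Linear disjointness: let K ⊆ M and let e span L over K while being
  -- independent over M. Then K-independent vectors with coordinates in M are
  -- also L-independent: expanding L-coefficients in e reduces an L-relation to
  -- M-relations among the e_i and then to K-relations among the vectors.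
  independence-lift : ∀ {K L M : C → Set ℓ} {N t l k} → IsSubfieldOfOrder F M N → (∀ {x} → K x → M x)
                      → (e : Fin t → V 1) → (∀ {y} → L y → InSpan K e ⟨ y ⟩) → LinIndep F M e
                      → (v : Fin k → V l) → (∀ j p → M (v j p)) → LinIndep F K v → LinIndep F L v
  independence-lift {K = K} {t = t} {l} {k} M-sub K⊆M e e-spans e-indep v v∈M v-indep a La av≈0 j =
    begin
      a j                    ≈⟨ coeffs-eq j zero ⟨
      lc (coeffs j) e zero   ≈⟨ lc-zero e (coeffs≈0 j) zero ⟩
      0#                     ∎
    where
    coeffs : Fin k → Fin t → C
    coeffs j = proj₁ (e-spans (La j))
    coeffs∈K : ∀ j i → K (coeffs j i)
    coeffs∈K j = proj₁ (proj₂ (e-spans (La j)))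
    coeffs-eq : ∀ j → lc (coeffs j) e ≈ᵥ ⟨ a j ⟩
    coeffs-eq j = proj₂ (proj₂ (e-spans (La j)))
    -- with a_j = Σ_i c_ji e_i, the vectors W_i = Σ_j c_ji v_j satisfy
    -- Σ_i W_i e_i = Σ_j a_j v_j = 0 coordinatewise
    W : Fin t → V l
    W i = lc (λ j → coeffs j i) v
    W-relation : ∀ p → lc (λ i → W i p) e zero ≈ 0#
    W-relation p = begin
      lc (λ i → W i p) e zero
        ≈⟨ lc-at _ e zero ⟩
      ∑[ i < t ] (W i p * e i zero)
        ≈⟨ sum-cong-≋ (λ i → *-congʳ (lc-at (λ j → coeffs j i) v p)) ⟩
      ∑[ i < t ] (∑[ j < k ] (coeffs j i * v j p) * e i zero)
        ≈⟨ sum-exchange coeffs (λ j → v j p) (λ i → e i zero) ⟩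
      ∑[ j < k ] (∑[ i < t ] (coeffs j i * e i zero) * v j p)
        ≈⟨ sum-cong-≋ (λ j → *-congʳ (trans (sym (lc-at (coeffs j) e zero)) (coeffs-eq j zero))) ⟩
      ∑[ j < k ] (a j * v j p)
        ≈⟨ lc-at a v p ⟨
      lc a v p
        ≈⟨ av≈0 p ⟩
      0# ∎
    W≈0 : ∀ i p → W i p ≈ 0#
    W≈0 i p = e-indep (λ i → W i p)
                (λ i → lc-closed (coordinates-closed M-sub K⊆M) (λ j → coeffs∈K j i) (λ j → v∈M j) p)
                (λ { zero → W-relation p }) i
    coeffs≈0 : ∀ j i → coeffs j i ≈ 0#
    coeffs≈0 j i = v-indep (λ j → coeffs j i) (λ j → coeffs∈K j i) (W≈0 i) j

  -- The F_{q^n}-span R of e contains F_{q^m} and is therefore also an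
  -- F_{q^m}-space; comparing |R| = (q^n)^d = (q^m)^d′ gives m ∣ d, while
  -- d ≤ t ≤ m, so no vector of e is redundant over F_{q^n}.
  module CoprimeDegrees (q m n : ℕ) (coprime : gcd n m ≡ 1) {Fq Fqm Fqn : C → Set ℓ}
         (Fq-sub : IsSubfieldOfOrder F Fq q) (Fqm-sub : IsSubfieldOfOrder F Fqm (q ℕ.^ m))
         (Fqn-sub : IsSubfieldOfOrder F Fqn (q ℕ.^ n)) where
    private
      module Sq = Subfield Fq-sub
      module Sm = Subfield Fqm-sub
      module Sn = Subfield Fqn-sub
      module Fqm = IsSubfieldOfOrder Fqm-sub

    Fq⊆Fqm : ∀ {x} → Fq x → Fqm x
    Fq⊆Fqm = subfield-⊆ m Fq-sub Fqm-sub

    Fq⊆Fqn : ∀ {x} → Fq x → Fqn x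
    Fq⊆Fqn = subfield-⊆ n Fq-sub Fqn-sub

    private
      Eq : Sq.Basis (λ i → ⟨ Fqm.enum i ⟩)
      Eq = Sq.basis (λ i → ⟨ Fqm.enum i ⟩)
      module Eq = Sq.Basis Eq

    t : ℕ
    t = Eq.d

    e : Fin t → V 1
    e = Eq.b

    e-spans : ∀ {y} → Fqm y → InSpan Fq e ⟨ y ⟩
    e-spans {y} y∈Fqm with Fqm.surjective y y∈Fqm
    ... | i , eᵢ≈y = LinearlyClosed.resp (Sq.span-closed e) (λ { zero → eᵢ≈y }) (Eq.w⊆span-b i)

    e∈Fqm : ∀ j p → Fqm (e j p)
    e∈Fqm j p with Eq.b⊆span-w j
    ... | a , Fq-a , eq = Fqm.resp (eq p)
                            (lc-closed (coordinates-closed Fqm-sub Fq⊆Fqm) Fq-a (λ i p → Fqm.enum-in i) p)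

    -- t ≤ m: the q^t distinct F_q-combinations of e all lie in F_{q^m}.
    t≤m : t ℕ.≤ m
    t≤m = ^-cancelˡ-≤ (subfield-card>1 Fq-sub) (ℕₚ.≤-trans
      (card-bound Fq-sub Fqm-sub e one Eq.independent in-Fqm-span-of-1)
      (ℕₚ.≤-reflexive (ℕₚ.^-identityʳ (q ℕ.^ m))))
      where
      one : Fin 1 → V 1
      one _ = ⟨ 1# ⟩
      in-Fqm-span-of-1 : ∀ a → (∀ j → Fq (a j)) → InSpan Fqm one (lc a e)
      in-Fqm-span-of-1 a Fq-a =
        (λ _ → lc a e zero) ,
        (λ _ → lc-closed (coordinates-closed Fqm-sub Fq⊆Fqm) Fq-a e∈Fqm zero) ,
        (λ { zero → trans (+-identityʳ _) (*-identityʳ _) })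

    -- R, the F_{q^n}-span of e (the compositum of F_{q^m} and F_{q^n}).
    R : V 1 → Set (c ⊔ ℓ)
    R = InSpan Fqn e

    R-Fqn-closed : LinearlyClosed Fqn R
    R-Fqn-closed = Sn.span-closed e

    Fqm⊆R : ∀ {y} → Fqm y → R ⟨ y ⟩
    Fqm⊆R y∈Fqm with e-spans y∈Fqm
    ... | a , Fq-a , eq = a , (λ j → Fq⊆Fqn (Fq-a j)) , eq

    -- y · Σ_j a_j e_j = Σ_j a_j (y e_j), and each y e_j ∈ F_{q^m} ⊆ R.
    R-Fqm-closed : LinearlyClosed Fqm R
    R-Fqm-closed = record
      { resp = LinearlyClosed.resp R-Fqn-closed ; has-0 = LinearlyClosed.has-0 R-Fqn-closed
      ; add = LinearlyClosed.add R-Fqn-closed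
      ; scale = λ { {y} y∈Fqm (a , Fqn-a , eq) →
          LinearlyClosed.resp R-Fqn-closed
            (≈ᵥ-trans (≈ᵥ-sym (lc-scale-vectors y a e)) (λ p → *-congˡ (eq p)))
            (lc-closed R-Fqn-closed Fqn-a (λ j →
              LinearlyClosed.resp R-Fqn-closed (λ { zero → refl })
                (Fqm⊆R (Fqm.closed-* y∈Fqm (e∈Fqm j zero))))) }
      }

    private
      Bn : Sn.Basis e
      Bn = Sn.basis e
      module Bn = Sn.Basis Bn
      Bm : Sm.Basis (Sn.comb Bn.b)
      Bm = Sm.basis (Sn.comb Bn.b)
      module Bm = Sm.Basis Bm

    d d′ : ℕ
    d = Bn.d
    d′ = Bm.d

    R⊆span-b : ∀ {x} → R x → InSpan Fqn Bn.b x
    R⊆span-b = Sn.span-mono Bn.w⊆span-b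

    R⊆span-b′ : ∀ {x} → R x → InSpan Fqm Bm.b x
    R⊆span-b′ x∈R with Sn.comb-surjective Bn.b (R⊆span-b x∈R)
    ... | i , bᵢ≈x = LinearlyClosed.resp (Sm.span-closed Bm.b) bᵢ≈x (Bm.w⊆span-b i)

    b′∈R : ∀ j → R (Bm.b j)
    b′∈R j with Bm.b⊆span-w j
    ... | a , Fqm-a , eq = LinearlyClosed.resp R-Fqm-closed eq
      (lc-closed R-Fqm-closed Fqm-a (λ i → lc-closed R-Fqn-closed (Sn.coeff∈K d i) Bn.b⊆span-w))

    card-R : (q ℕ.^ n) ℕ.^ d ≡ (q ℕ.^ m) ℕ.^ d′
    card-R = ℕₚ.≤-antisym
      (card-bound Fqn-sub Fqm-sub Bn.b Bm.b Bn.independent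
        (λ a Fqn-a → R⊆span-b′ (lc-closed R-Fqn-closed Fqn-a Bn.b⊆span-w)))
      (card-bound Fqm-sub Fqn-sub Bm.b Bn.b Bm.independent
        (λ a Fqm-a → R⊆span-b (lc-closed R-Fqm-closed Fqm-a b′∈R)))

    nd≡md′ : n ℕ.* d ≡ m ℕ.* d′
    nd≡md′ = ^-cancelˡ-≡ (subfield-card>1 Fq-sub)
      (≡.trans (≡.sym (ℕₚ.^-*-assoc q n d)) (≡.trans card-R (ℕₚ.^-*-assoc q m d′)))

    m∣d : m ∣ d
    m∣d = Coprimality.coprime-divisor (Coprimality.sym (Coprimality.gcd≡1⇒coprime {n} {m} coprime))
                                      (divides d′ (≡.trans nd≡md′ (ℕₚ.*-comm m d′)))

    -- d > 0, since 1 ∈ R.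
    0<d : 0 ℕ.< d
    0<d = span-nonzero⇒nonempty {K = Fqn} Bn.b (R⊆span-b (Fqm⊆R Fqm.has-1)) (λ 1≈0 → 1≉0 (1≈0 zero))

    -- d < t is excluded by t ≤ m ≤ d, so the extraction kept all of e.
    e-independent : LinIndep F Fqn e
    e-independent with Bn.shorter-or-independent
    ... | inj₂ indep = indep
    ... | inj₁ d<t = ⊥-elim (ℕₚ.<⇒≱ d<t (ℕₚ.≤-trans t≤m (∣⇒≤ {{ℕ.>-nonZero 0<d}} m∣d)))

open import Data.Nat using (ℕ; _*_; _^_; _≤_; NonZero)

lemma3p1 : ∀ {c ℓ : Level} (q δ l m n : ℕ) → IsPrimePower q
    → .{{NonZero δ}} → .{{NonZero l}} → .{{NonZero m}} → .{{NonZero n}}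
    → gcd n m ≡ 1 → δ ≤ l
    → (F : CommutativeRing c ℓ) → IsField F → HasCard F (q ^ (m * n))
    → (Fq Fqm Fqn : CommutativeRing.Carrier F → Set ℓ)
    → IsSubfieldOfOrder F Fq q → IsSubfieldOfOrder F Fqm (q ^ m)
    → IsSubfieldOfOrder F Fqn (q ^ n)
    → (U : Vec F l → Set ℓ) → IsSubspace F Fqm U → HasDim F Fqm U δ
    → DimLe F Fq (_∩Sub_ F U Fqn) δ
lemma3p1 q δ l m n _ coprime _ F isField card Fq Fqm Fqn Fq-sub Fqm-sub Fqn-sub
         U U-sub (u , _ , _ , u-spans) k v v∈U∩Fqnˡ v-Fq-indep =
  ^-cancelˡ-≤ (subfield-card>1 Fqm-sub)
    (card-bound Fqm-sub Fqm-sub v u v-Fqm-indep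
      (λ a Fqm-a → u-spans _ (lc-closed (subspace⇒closed U-sub) Fqm-a (λ j → proj₁ (v∈U∩Fqnˡ j)))))
  where
  open FiniteField F isField (hasCard⇒decidable F card)
  open CoprimeDegrees q m n coprime Fq-sub Fqm-sub Fqn-sub using (Fq⊆Fqn; e; e-spans; e-independent)
  v-Fqm-indep : LinIndep F Fqm v
  v-Fqm-indep = independence-lift Fqn-sub Fq⊆Fqn e e-spans e-independent
                                  v (λ j → proj₂ (v∈U∩Fqnˡ j)) v-Fq-indep
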